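{- Let $G=(V,E)$ be a graph that has at least one split independent set. Then every maximal split independent set $S$ of $G$ is a minimal split dominating set of $G$.
   Context: All graphs are finite, undirected, simple (no loops or multiple edges), connected, and have no isolated vertices. $N[v]$ denotes the closed neighborhood of $v$ and $N[S]=\bigcup_{v\in S}N[v]$. A set $S\subseteq V$ is dominating if $N[S]=V$. A set $S$ is independent if $\langle S\rangle$ has no edges. A split independent set is an independent set $S$ such that the induced subgraph $\langle V\setminus S\rangle$ is disconnected or a $K_1$. A maximal split independent set is a split independent set $S$ such that for every $v\in V\setminus S$ at least one of the following holds: (1) $S\cup\{v\}$ is not independent; (2) the induced subgraph $\langle V\setminus (S\cup\{v\})\rangle$ is connected. A split dominating set is a dominating set $S$ such that $\langle V\setminus S\rangle$ is disconnected or a $K_1$. A split dominating set $S$ is a minimal split dominating set if for every $v\in S$ at least one of the following holds: (1) $v$ has a private neighbor with respect to $S$, i.e. there is $w\in N[v]$ with $w\notin N[S\setminus\{v\}]$; (2) the induced subgraph $\langle (V\setminus S)\cup\{v\}\rangle$ is connected. -}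

module Defs where

open import Data.Nat using (ℕ)
open import Data.Fin using (Fin)
open import Data.Product using (Σ; ∃; _×_; _,_)
open import Data.Sum using (_⊎_)
open import Data.Empty using (⊥)
open import Relation.Nullary using (¬_)
open import Relation.Binary.PropositionalEquality using (_≡_; _≢_)
open import Data.Bool using (Bool; true; false; T; not; _∧_; _∨_)
open import Data.Fin using (_≟_)
open import Relation.Nullary.Decidable using (⌊_⌋)

record Graph (n : ℕ) : Set₁ where
  field
    adj     : Fin n → Fin n → Bool
    irrefl  : ∀ v → adj v v ≡ false
    sym     : ∀ u v → adj u v ≡ adj v u

  Adj : Fin n → Fin n → Set
  Adj u v = T (adj u v)

VSet : ℕ → Set
VSet n = Fin n → Bool

infix 4 _∈_
_∈_ : ∀ {n} → Fin n → VSet n → Set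
v ∈ S = T (S v)

module _ {n : ℕ} (G : Graph n) where
  open Graph G

  _ᶜ : VSet n → VSet n
  (S ᶜ) v = not (S v)

  _∪｛_｝ : VSet n → Fin n → VSet n
  (S ∪｛ w ｝) v = S v ∨ ⌊ v ≟ w ⌋

  _∖｛_｝ : VSet n → Fin n → VSet n
  (S ∖｛ w ｝) v = S v ∧ not ⌊ v ≟ w ⌋

  data Walk (U : VSet n) : Fin n → Fin n → Set where
    here : ∀ {u} → u ∈ U → Walk U u u
    step : ∀ {u w v} → u ∈ U → Adj u w → Walk U w v → Walk U u v

  InducedConnected : VSet n → Set
  InducedConnected U = (∃ λ v → v ∈ U) × (∀ u v → u ∈ U → v ∈ U → Walk U u v)

  -- ⟨U⟩ is isomorphic to K₁: exactly one vertex
  InducedK1 : VSet n → Set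
  InducedK1 U = ∃ λ v → v ∈ U × (∀ u → u ∈ U → u ≡ v)

  Connected : Set
  Connected = InducedConnected (λ _ → true)

  NoIsolated : Set
  NoIsolated = ∀ v → ∃ λ w → Adj v w

  InN : Fin n → Fin n → Set
  InN v w = w ≡ v ⊎ Adj v w

  InNS : VSet n → Fin n → Set
  InNS S w = ∃ λ v → v ∈ S × InN v w

  Dominating : VSet n → Set
  Dominating S = ∀ w → InNS S w

  Independent : VSet n → Set
  Independent S = ∀ u v → u ∈ S → v ∈ S → ¬ Adj u v

  Splits : VSet n → Set
  Splits S = ¬ InducedConnected (S ᶜ) ⊎ InducedK1 (S ᶜ)

  SplitIndependent : VSet n → Set
  SplitIndependent S = Independent S × Splits S

  MaximalSplitIndependent : VSet n → Set
  MaximalSplitIndependent S =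
    SplitIndependent S ×
    (∀ v → ¬ (v ∈ S) →
       ¬ Independent (S ∪｛ v ｝) ⊎ InducedConnected ((S ∪｛ v ｝) ᶜ))

  SplitDominating : VSet n → Set
  SplitDominating S = Dominating S × Splits S

  HasPrivateNeighbour : VSet n → Fin n → Set
  HasPrivateNeighbour S v = ∃ λ w → InN v w × ¬ InNS (S ∖｛ v ｝) w

  MinimalSplitDominating : VSet n → Set
  MinimalSplitDominating S =
    SplitDominating S ×
    (∀ v → v ∈ S →
       HasPrivateNeighbour S v ⊎ InducedConnected ((S ᶜ) ∪｛ v ｝))

-- Every vertex of an independent set is its own private neighbour, so only domination needs
-- maximality. If w ∉ S had no neighbour in S, then S ∪ {w} would be independent, so by maximality
-- V ∖ (S ∪ {w}) would be connected; as w has a neighbour there, V ∖ S would be connected with at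
-- least two vertices, and S would not split G.
module Submission where

open import Defs hiding (_ᶜ; _∪｛_｝; _∖｛_｝)
import Defs
open import Data.Nat using (ℕ)
open import Data.Product using (∃; _×_; _,_; proj₁; proj₂)
open import Data.Sum using (_⊎_; inj₁; inj₂; [_,_]′)
open import Data.Empty using (⊥-elim)
open import Data.Bool using (true; false; T; not)
open import Data.Bool.Properties using (T-∧; T-∨; T?)
open import Data.Fin using (Fin; _≟_)
open import Data.Fin.Properties using (any?)
open import Function.Bundles using (Equivalence)
open import Relation.Nullary using (¬_; Dec; yes; no)
open import Relation.Nullary.Decidable
  using (toWitness; fromWitness; toWitnessFalse; _×-dec_; _⊎-dec_)
open import Relation.Binary.PropositionalEquality using (_≡_; _≢_; refl; sym; trans; subst)

T-not⁺ : ∀ {b} → ¬ T b → T (not b)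
T-not⁺ {false} _ = _
T-not⁺ {true}  ¬t = ¬t _

T-not⁻ : ∀ {b} → T (not b) → ¬ T b
T-not⁻ {false} _ ()

module _ {n : ℕ} (G : Graph n) where
  open Graph G hiding (sym)

  private
    _ᶜ : VSet n → VSet n
    _ᶜ = Defs._ᶜ G

    _∪｛_｝ : VSet n → Fin n → VSet n
    _∪｛_｝ = Defs._∪｛_｝ G

    _∖｛_｝ : VSet n → Fin n → VSet n
    _∖｛_｝ = Defs._∖｛_｝ G

  _⊆_ : VSet n → VSet n → Set
  U ⊆ U′ = ∀ {a} → a ∈ U → a ∈ U′

  ∈ᶜ⁺ : ∀ S {a} → ¬ a ∈ S → a ∈ S ᶜ
  ∈ᶜ⁺ _ = T-not⁺

  ∈ᶜ⁻ : ∀ S {a} → a ∈ S ᶜ → ¬ a ∈ S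
  ∈ᶜ⁻ _ = T-not⁻

  ∈-∪｛｝⁺ : ∀ S w {a} → a ∈ S ⊎ a ≡ w → a ∈ S ∪｛ w ｝
  ∈-∪｛｝⁺ S _ {a} (inj₁ a∈S) = Equivalence.from (T-∨ {S a}) (inj₁ a∈S)
  ∈-∪｛｝⁺ S _ {a} (inj₂ a≡w) = Equivalence.from (T-∨ {S a}) (inj₂ (fromWitness a≡w))

  ∈-∪｛｝⁻ : ∀ S w {a} → a ∈ S ∪｛ w ｝ → a ∈ S ⊎ a ≡ w
  ∈-∪｛｝⁻ S w {a} t with Equivalence.to (T-∨ {S a}) t
  ... | inj₁ a∈S = inj₁ a∈S
  ... | inj₂ a≟w = inj₂ (toWitness {a? = a ≟ w} a≟w)

  ∈-∖｛｝⁻ : ∀ S w {a} → a ∈ S ∖｛ w ｝ → a ∈ S × a ≢ w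
  ∈-∖｛｝⁻ S w {a} t with Equivalence.to (T-∧ {S a}) t
  ... | a∈S , a≢w = a∈S , toWitnessFalse {a? = a ≟ w} a≢w

  Adj-sym : ∀ {u v} → Adj u v → Adj v u
  Adj-sym {u} {v} = subst T (Graph.sym G u v)

  Adj-irrefl : ∀ {u v} → Adj u v → u ≢ v
  Adj-irrefl {u} a refl = subst T (irrefl u) a

  Walk-source : ∀ {U u v} → Walk G U u v → u ∈ U
  Walk-source (here u∈U)     = u∈U
  Walk-source (step u∈U _ _) = u∈U

  Walk-mono : ∀ {U U′} → U ⊆ U′ → ∀ {u v} → Walk G U u v → Walk G U′ u v
  Walk-mono U⊆U′ (here u∈U)        = here (U⊆U′ u∈U)
  Walk-mono U⊆U′ (step u∈U a walk) = step (U⊆U′ u∈U) a (Walk-mono U⊆U′ walk)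

  Walk-++ : ∀ {U u v w} → Walk G U u v → Walk G U v w → Walk G U u w
  Walk-++ (here _)       q = q
  Walk-++ (step u∈U a p) q = step u∈U a (Walk-++ p q)

  Walk-reverse : ∀ {U u v} → Walk G U u v → Walk G U v u
  Walk-reverse (here u∈U)        = here u∈U
  Walk-reverse (step u∈U a walk) =
    Walk-++ (Walk-reverse walk) (step (Walk-source walk) (Adj-sym a) (here u∈U))

  InducedConnected-extend : ∀ {U U′ w x} → U ⊆ U′ → U′ ⊆ (U ∪｛ w ｝) → w ∈ U′ → x ∈ U → Adj w x →
                            InducedConnected G U → InducedConnected G U′
  InducedConnected-extend {U} {U′} {w} {x} U⊆U′ U′⊆U+w w∈U′ x∈U wx (_ , walkU) =
    (w , w∈U′) , λ u v u∈U′ v∈U′ → Walk-++ (toX u∈U′) (Walk-reverse (toX v∈U′))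
    where
    toX : ∀ {u} → u ∈ U′ → Walk G U′ u x
    toX {u} u∈U′ with ∈-∪｛｝⁻ U w (U′⊆U+w u∈U′)
    ... | inj₁ u∈U  = Walk-mono U⊆U′ (walkU u x u∈U x∈U)
    ... | inj₂ refl = step w∈U′ wx (here (U⊆U′ x∈U))

  Splits⇒disconnected : ∀ {S x y} → Splits G S → x ∈ S ᶜ → y ∈ S ᶜ → x ≢ y →
                        ¬ InducedConnected G (S ᶜ)
  Splits⇒disconnected (inj₁ disconnected)      _   _   _   = disconnected
  Splits⇒disconnected (inj₂ (_ , _ , unique)) x∈ y∈ x≢y _ = x≢y (trans (unique _ x∈) (sym (unique _ y∈)))

  Independent-∪｛｝ : ∀ {S w} → Independent G S → (∀ u → u ∈ S → ¬ Adj u w) →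
                      Independent G (S ∪｛ w ｝)
  Independent-∪｛｝ {S} {w} indep noNeighbour a b a∈ b∈ ab with ∈-∪｛｝⁻ S w a∈ | ∈-∪｛｝⁻ S w b∈
  ... | inj₁ a∈S  | inj₁ b∈S  = indep a b a∈S b∈S ab
  ... | inj₁ a∈S  | inj₂ refl = noNeighbour a a∈S ab
  ... | inj₂ refl | inj₁ b∈S  = noNeighbour b b∈S (Adj-sym ab)
  ... | inj₂ refl | inj₂ refl = Adj-irrefl ab refl

  Independent⇒selfPrivate : ∀ {S v} → Independent G S → v ∈ S → HasPrivateNeighbour G S v
  Independent⇒selfPrivate {S} {v} indep v∈S = v , inj₁ refl , λ where
    (u , u∈S-v , inj₁ v≡u) → proj₂ (∈-∖｛｝⁻ S v u∈S-v) (sym v≡u)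
    (u , u∈S-v , inj₂ uv)  → indep u v (proj₁ (∈-∖｛｝⁻ S v u∈S-v)) v∈S uv

  InNS? : ∀ S w → Dec (InNS G S w)
  InNS? S w = any? λ v → T? (S v) ×-dec (w ≟ v ⊎-dec T? (adj v w))

  InducedConnected-ᶜ-∪｛｝ : ∀ {S w x} → ¬ w ∈ S → x ∈ (S ∪｛ w ｝) ᶜ → Adj w x →
                            InducedConnected G ((S ∪｛ w ｝) ᶜ) → InducedConnected G (S ᶜ)
  InducedConnected-ᶜ-∪｛｝ {S} {w} w∉S x∉S+w wx =
    InducedConnected-extend shrink grow (∈ᶜ⁺ S w∉S) x∉S+w wx
    where
    shrink : ((S ∪｛ w ｝) ᶜ) ⊆ (S ᶜ)
    shrink a∉S+w = ∈ᶜ⁺ S λ a∈S → ∈ᶜ⁻ (S ∪｛ w ｝) a∉S+w (∈-∪｛｝⁺ S w (inj₁ a∈S))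

    grow : (S ᶜ) ⊆ (((S ∪｛ w ｝) ᶜ) ∪｛ w ｝)
    grow {a} a∉S = byCases (a ≟ w)
      where
      byCases : Dec (a ≡ w) → a ∈ ((S ∪｛ w ｝) ᶜ) ∪｛ w ｝
      byCases (yes a≡w) = ∈-∪｛｝⁺ ((S ∪｛ w ｝) ᶜ) w (inj₂ a≡w)
      byCases (no a≢w)  = ∈-∪｛｝⁺ ((S ∪｛ w ｝) ᶜ) w (inj₁ (∈ᶜ⁺ (S ∪｛ w ｝) λ a∈S+w →
                            [ ∈ᶜ⁻ S a∉S , a≢w ]′ (∈-∪｛｝⁻ S w a∈S+w)))

  MaximalSplitIndependent⇒Dominating : ∀ {S} → NoIsolated G → MaximalSplitIndependent G S →
                                         Dominating G S
  MaximalSplitIndependent⇒Dominating {S} noIsolated ((indep , splits) , maximal) w with InNS? S w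
  ... | yes dominated  = dominated
  ... | no undominated =
    ⊥-elim ([ (λ notIndep → notIndep (Independent-∪｛｝ indep noNeighbour))
            , (λ connected → Splits⇒disconnected splits (∈ᶜ⁺ S w∉S) x∈Sᶜ (Adj-irrefl wx)
                               (InducedConnected-ᶜ-∪｛｝ w∉S x∉S+w wx connected))
            ]′ (maximal w w∉S))
    where
    w∉S : ¬ w ∈ S
    w∉S w∈S = undominated (w , w∈S , inj₁ refl)

    noNeighbour : ∀ u → u ∈ S → ¬ Adj u w
    noNeighbour u u∈S uw = undominated (u , u∈S , inj₂ uw)

    x : Fin n
    x = proj₁ (noIsolated w)

    wx : Adj w x
    wx = proj₂ (noIsolated w)

    x∈Sᶜ : x ∈ S ᶜ
    x∈Sᶜ = ∈ᶜ⁺ S λ x∈S → noNeighbour x x∈S (Adj-sym wx)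

    x∉S+w : x ∈ (S ∪｛ w ｝) ᶜ
    x∉S+w = ∈ᶜ⁺ (S ∪｛ w ｝) λ x∈S+w →
      [ ∈ᶜ⁻ S x∈Sᶜ , (λ x≡w → Adj-irrefl wx (sym x≡w)) ]′ (∈-∪｛｝⁻ S w x∈S+w)

mainTheorem2 : ∀ {n : ℕ} (G : Graph n) → Connected G → NoIsolated G →
    (∃ λ T → SplitIndependent G T) →
    ∀ (S : VSet n) → MaximalSplitIndependent G S → MinimalSplitDominating G S
mainTheorem2 G _ noIsolated _ S maximal@((indep , splits) , _) =
  (MaximalSplitIndependent⇒Dominating G noIsolated maximal , splits) ,
  λ v v∈S → inj₁ (Independent⇒selfPrivate G indep v∈S)
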